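{- Let $\ell,s_1,s_2$ be positive integers and $n\ge \ell+2^{s_1+s_2}$. Then every tournament on $n$ vertices contains a $(\vec{P}_\ell,s_1,s_2)$-broom.
   Context: $\vec{P}_\ell$ is the directed path $x_1\to x_2\to\dots\to x_{\ell+1}$ of length $\ell$. For an oriented path $P=x_1\dots x_k$ with $k\ge2$ vertices and integers $s_1,s_2$, a $(P,s_1,s_2)$-broom is the digraph obtained from $P$ by replacing $x_1$ by $s_1$ new vertices and $x_k$ by $s_2$ new vertices, each of which is joined to $x_2$ (resp. $x_{k-1}$) by an arc oriented the same way as the arc between $x_1$ and $x_2$ (resp. between $x_{k-1}$ and $x_k$) in $P$; if $k=2$, this is the complete bipartite digraph from the $s_1$ copies of $x_1$ to the $s_2$ copies of $x_2$ with all arcs oriented as in $P$. A tournament contains a broom if it contains a copy of it as a subdigraph. -}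

module Defs where

open import Data.Nat using (ℕ; zero; suc; _∸_)
open import Data.Fin using (Fin; toℕ)
open import Data.Bool using (Bool; true; false; not)
open import Data.Sum using (_⊎_; inj₁; inj₂)
open import Data.Empty using (⊥)
open import Data.Product using (Σ; _×_)
open import Relation.Binary.PropositionalEquality using (_≡_; _≢_)
open import Function.Definitions using (Injective)

record Tournament (n : ℕ) : Set where
  field
    arc        : Fin n → Fin n → Bool
    irrefl     : ∀ u → arc u u ≡ false
    tournament : ∀ u v → u ≢ v → arc v u ≡ not (arc u v)

-- The path is x₁ → x₂ → … → x_{ℓ+1}.  x₁ is replaced by s₁ new vertices
-- (inj₁), x_{ℓ+1} by s₂ new vertices (inj₂ ∘ inj₂); the internal vertices
-- x₂ … x_ℓ (ℓ ∸ 1 of them) are kept (inj₂ ∘ inj₁), where internal vertex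
-- i : Fin (ℓ ∸ 1) stands for x_{toℕ i + 2}.
BroomV : ℕ → ℕ → ℕ → Set
BroomV ℓ s₁ s₂ = Fin s₁ ⊎ (Fin (ℓ ∸ 1) ⊎ Fin s₂)

BroomArc : (ℓ s₁ s₂ : ℕ) → BroomV ℓ s₁ s₂ → BroomV ℓ s₁ s₂ → Set
-- copies of x₁ → x₂  (when ℓ ≥ 2, x₂ is the internal vertex 0)
BroomArc ℓ s₁ s₂ (inj₁ a) (inj₂ (inj₁ j)) = toℕ j ≡ 0
-- copies of x₁ → copies of x₂ (only when ℓ = 1: complete bipartite digraph)
BroomArc ℓ s₁ s₂ (inj₁ a) (inj₂ (inj₂ b)) = ℓ ≡ 1
-- x_{i+2} → x_{i+3} along the path
BroomArc ℓ s₁ s₂ (inj₂ (inj₁ i)) (inj₂ (inj₁ j)) = toℕ j ≡ suc (toℕ i)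
-- x_ℓ → copies of x_{ℓ+1}
BroomArc ℓ s₁ s₂ (inj₂ (inj₁ i)) (inj₂ (inj₂ b)) = suc (toℕ i) ≡ ℓ ∸ 1
BroomArc ℓ s₁ s₂ _ _ = ⊥

ContainsBroom : ∀ {n} → Tournament n → (ℓ s₁ s₂ : ℕ) → Set
ContainsBroom {n} T ℓ s₁ s₂ =
  Σ (BroomV ℓ s₁ s₂ → Fin n) λ f →
    Injective _≡_ _≡_ f ×
    (∀ u v → BroomArc ℓ s₁ s₂ u v → Tournament.arc T (f u) (f v) ≡ true)

{-# OPTIONS --safe #-}
module Submission where

-- For ℓ = 1 the broom is a complete bipartite digraph from s₁ sources to s₂ sinks, found by
-- halving: among 2^(a+b) vertices, a vertex v has 2^(a+b-1) out-neighbours or 2^(a+b-1)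
-- in-neighbours among the others, and v is added as a source resp. sink to an (a-1, b)- resp.
-- (a, b-1)-biclique found recursively in that neighbourhood.
--
-- For ℓ ≥ 2, cut an ordering of the vertices into a front block of 2s₁ vertices, a middle block
-- of ℓ-1 vertices and a back block of at least 2s₂ vertices (these fit since 2m ≤ 2^m + 1).
-- Each of the following moves strictly increases the number of forward arcs of the ordering:
-- swapping a backward consecutive pair of the middle block; moving the first middle vertex in
-- front of the front block when fewer than s₁ front vertices dominate it (so more than s₁ are
-- dominated by it); moving the last middle vertex behind the back block when it dominates fewer
-- than s₂ back vertices. As the number of forward arcs is bounded, we reach an ordering where
-- no move applies: there the middle block is a directed path whose first vertex has s₁
-- in-neighbours in the front and whose last vertex has s₂ out-neighbours in the back.

open import Algebra.Properties.CommutativeSemigroup using (xy∙z≈xz∙y)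
open import Data.Bool using (Bool; true; false)
import Data.Bool.Properties as Bool
open import Data.Empty using (⊥-elim)
open import Data.Fin using (Fin; zero; suc; toℕ; inject≤)
open import Data.Fin.Properties using (inject≤-injective)
open import Data.List using (List; []; _∷_; _++_; _∷ʳ_; [_]; length; lookup; filter; allFin; initLast; _∷ʳ′_)
open import Data.List.Properties
  using (++-assoc; ++-identityʳ; ∷ʳ-++; length-++; length-tabulate; length-filter; filter-++)
open import Data.List.Membership.Propositional using (_∈_; _∉_)
open import Data.List.Membership.Propositional.Properties using (∈-lookup; ∈-++⁺ˡ; ∈-++⁺ʳ; ∈-filter⁻)
open import Data.List.Relation.Unary.Any using (here; there)
import Data.List.Relation.Unary.All as All
open All using (_∷_)
open import Data.List.Relation.Unary.Linked using (Linked; []; [-]; _∷_; tail)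
open import Data.List.Relation.Unary.Unique.Propositional using (Unique; []; _∷_)
open import Data.List.Relation.Unary.Unique.Propositional.Properties
  using (Unique[x∷xs]⇒x∉xs; allFin⁺) renaming (++⁺ to Unique-++⁺; filter⁺ to Unique-filter⁺)
open import Data.List.Relation.Binary.Disjoint.Propositional using (Disjoint)
import Data.List.Relation.Binary.Sublist.Propositional as Sublist
open Sublist using (_⊆_; []; _∷_; ⊆-refl; ⊆-trans)
open import Data.List.Relation.Binary.Sublist.Propositional.Properties
  using (All-resp-⊆; ++⁺; ++⁺ˡ; ++⁺ʳ; filter-⊆; []⊆-universal)
open import Data.List.Relation.Binary.Permutation.Propositional
  using (_↭_; refl; swap; ↭-sym; ↭-trans; ↭-reflexive; ↭⇒↭ₛ)
open import Data.List.Relation.Binary.Permutation.Propositional.Properties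
  using (↭-length; filter-↭; shift; ∷↭∷ʳ) renaming (++⁺ˡ to ↭-++⁺ˡ; ++⁺ʳ to ↭-++⁺ʳ)
import Data.List.Relation.Binary.Permutation.Setoid.Properties as PermutationSetoid
open import Data.Nat using (ℕ; zero; suc; _+_; _*_; _^_; _≤_; _<_; z≤n; s≤s; s≤s⁻¹)
open import Data.Nat.Properties
open import Data.Nat.Tactic.RingSolver using (solve-∀)
open import Data.Product using (Σ; ∃₂; _×_; _,_; proj₂)
open import Data.Sum using (_⊎_; inj₁; inj₂; [_,_]′)
open import Function using (id; _∘_)
open import Function.Definitions using (Injective)
open import Level using (0ℓ)
open import Relation.Binary using (Rel; Decidable)
open import Relation.Binary.PropositionalEquality
  using (_≡_; _≢_; refl; sym; trans; cong; cong₂; subst; subst₂; setoid; module ≡-Reasoning)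
open import Relation.Nullary using (¬_; yes; no)

open import Defs

n<2^n : ∀ n → n < 2 ^ n
n<2^n zero    = s≤s z≤n
n<2^n (suc n) = begin-strict
  suc n          ≡⟨ +-comm 1 n ⟩
  n + 1          <⟨ +-mono-<-≤ (n<2^n n) (m^n>0 2 n) ⟩
  2 ^ n + 2 ^ n  ≡⟨ cong (2 ^ n +_) (+-identityʳ (2 ^ n)) ⟨
  2 ^ suc n      ∎
  where open ≤-Reasoning

double≤1+2^ : ∀ m → m + m ≤ suc (2 ^ m)
double≤1+2^ zero    = z≤n
double≤1+2^ (suc m) = begin
  suc m + suc m        ≡⟨ cong suc (+-suc m m) ⟩
  suc (suc (m + m))    ≤⟨ s≤s (+-mono-≤ (n<2^n m) (<⇒≤ (n<2^n m))) ⟩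
  suc (2 ^ m + 2 ^ m)  ≡⟨ cong (λ x → suc (2 ^ m + x)) (+-identityʳ (2 ^ m)) ⟨
  suc (2 ^ suc m)      ∎
  where open ≤-Reasoning

blocks-fit : ∀ s₁ s₂ k → s₁ + s₁ + (k + (s₂ + s₂)) ≤ suc k + 2 ^ (s₁ + s₂)
blocks-fit s₁ s₂ k = begin
  s₁ + s₁ + (k + (s₂ + s₂))    ≡⟨ rearrange s₁ s₂ k ⟩
  k + (s₁ + s₂ + (s₁ + s₂))    ≤⟨ +-monoʳ-≤ k (double≤1+2^ (s₁ + s₂)) ⟩
  k + suc (2 ^ (s₁ + s₂))      ≡⟨ +-suc k _ ⟩
  suc k + 2 ^ (s₁ + s₂)        ∎
  where
  open ≤-Reasoning
  rearrange : ∀ a b k → a + a + (k + (b + b)) ≡ k + (a + b + (a + b))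
  rearrange = solve-∀

majority : ∀ {M m n} → M + M ≤ suc (m + n) → m < M → M ≤ n
majority {M} {m} {n} 2M≤ m<M with M ≤? n
... | yes M≤n = M≤n
... | no  M≰n = ⊥-elim (<-irrefl refl (begin-strict
  suc (m + n)    <⟨ s≤s (+-monoʳ-< m (n<1+n n)) ⟩
  suc m + suc n  ≤⟨ +-mono-≤ m<M (≰⇒> M≰n) ⟩
  M + M          ≤⟨ 2M≤ ⟩
  suc (m + n)    ∎))
  where open ≤-Reasoning

minority : ∀ {s m n} → s + s ≤ m + n → m < s → m < n
minority 2s≤ m<s = <-≤-trans m<s (majority (≤-trans 2s≤ (n≤1+n _)) m<s)

exchange-< : ∀ {m n o p} → m + n ≡ o + p → n < p → o < m
exchange-< eq n<p = ≰⇒> (λ m≤o → <-irrefl eq (+-mono-≤-< m≤o n<p))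

hill-climb : ∀ {S G : Set} (h : S → ℕ) (bound : ℕ) → (∀ s → h s ≤ bound) →
             (∀ s → G ⊎ Σ S λ s′ → h s < h s′) → S → G
hill-climb {S} {G} h bound h≤bound step s₀ = climb (suc bound) s₀ (s≤s (m≤m+n bound (h s₀)))
  where
  climb : ∀ fuel s → bound < fuel + h s → G
  climb zero       s bound<h = ⊥-elim (<⇒≱ bound<h (h≤bound s))
  climb (suc fuel) s bound<  with step s
  ... | inj₁ g           = g
  ... | inj₂ (s′ , h<h′) = climb fuel s′ (<-≤-trans bound< (begin
    suc fuel + h s    ≡⟨ +-suc fuel (h s) ⟨
    fuel + suc (h s)  ≤⟨ +-monoʳ-≤ fuel h<h′ ⟩
    fuel + h s′       ∎))
    where open ≤-Reasoning

module _ {A : Set} where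

  Unique-resp-⊇ : ∀ {xs ys : List A} → xs ⊆ ys → Unique ys → Unique xs
  Unique-resp-⊇ []                    []         = []
  Unique-resp-⊇ (Sublist._∷ʳ_ _ xs⊆) (_ ∷ ys!)  = Unique-resp-⊇ xs⊆ ys!
  Unique-resp-⊇ (refl ∷ xs⊆)          (y∉ ∷ ys!) = All-resp-⊆ xs⊆ y∉ ∷ Unique-resp-⊇ xs⊆ ys!

  Unique-++⁻ˡ : ∀ xs {ys : List A} → Unique (xs ++ ys) → Unique xs
  Unique-++⁻ˡ xs {ys} = Unique-resp-⊇ (++⁺ʳ ys ⊆-refl)

  Unique-++⁻ʳ : ∀ xs {ys : List A} → Unique (xs ++ ys) → Unique ys
  Unique-++⁻ʳ xs = Unique-resp-⊇ (++⁺ˡ xs ⊆-refl)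

  Unique-++⇒Disjoint : ∀ xs {ys : List A} → Unique (xs ++ ys) → Disjoint xs ys
  Unique-++⇒Disjoint (x ∷ xs) (x∉ ∷ _)  (here refl  , v∈ys) = All.lookup x∉ (∈-++⁺ʳ xs v∈ys) refl
  Unique-++⇒Disjoint (x ∷ xs) (_ ∷ xs!) (there v∈xs , v∈ys) = Unique-++⇒Disjoint xs xs! (v∈xs , v∈ys)

  Unique-resp-↭ : ∀ {xs ys : List A} → xs ↭ ys → Unique xs → Unique ys
  Unique-resp-↭ xs↭ys = PermutationSetoid.Unique-resp-↭ (setoid A) (↭⇒↭ₛ xs↭ys)

  lookup-injective : ∀ {xs : List A} → Unique xs → Injective _≡_ _≡_ (lookup xs)
  lookup-injective {x ∷ xs} _         {zero}  {zero}  _  = refl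
  lookup-injective {x ∷ xs} (x∉ ∷ _)  {zero}  {suc j} eq = ⊥-elim (All.lookup x∉ (∈-lookup j) eq)
  lookup-injective {x ∷ xs} (x∉ ∷ _)  {suc i} {zero}  eq = ⊥-elim (All.lookup x∉ (∈-lookup i) (sym eq))
  lookup-injective {x ∷ xs} (_ ∷ xs!) {suc i} {suc j} eq = cong suc (lookup-injective xs! eq)

  pick : ∀ {s} (xs : List A) → s ≤ length xs → Fin s → A
  pick xs s≤ i = lookup xs (inject≤ i s≤)

  pick-∈ : ∀ {s} {xs : List A} (s≤ : s ≤ length xs) i → pick xs s≤ i ∈ xs
  pick-∈ s≤ i = ∈-lookup (inject≤ i s≤)

  pick-injective : ∀ {s} {xs : List A} (s≤ : s ≤ length xs) → Unique xs →
                   Injective _≡_ _≡_ (pick xs s≤)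
  pick-injective s≤ xs! eq = inject≤-injective s≤ s≤ _ _ (lookup-injective xs! eq)

  regroup : ∀ (P X Y S : List A) → P ++ (X ++ Y) ++ S ≡ (P ++ X) ++ Y ++ S
  regroup P X Y S = trans (cong (P ++_) (++-assoc X Y S)) (sym (++-assoc P X (Y ++ S)))

  split-at : ∀ m {r} (xs : List A) → m + r ≤ length xs →
             ∃₂ λ ys zs → ys ++ zs ≡ xs × length ys ≡ m × r ≤ length zs
  split-at zero    xs       r≤   = [] , xs , refl , refl , r≤
  split-at (suc m) (x ∷ xs) m+r< with split-at m xs (s≤s⁻¹ m+r<)
  ... | ys , zs , ys++zs≡xs , ys-len , r≤ = x ∷ ys , zs , cong (x ∷_) ys++zs≡xs , cong suc ys-len , r≤

  unsnoc : ∀ (y : A) ys → ∃₂ λ xs z → y ∷ ys ≡ xs ∷ʳ z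
  unsnoc y ys with initLast ys
  ... | []       = [] , y , refl
  ... | xs ∷ʳ′ z = y ∷ xs , z , refl

length-allFin : ∀ n → length (allFin n) ≡ n
length-allFin n = length-tabulate id

module _ {I J A : Set} {f : I → A} {g : J → A} {xs ys : List A} where

  [,]-∈-++ : (∀ i → f i ∈ xs) → (∀ j → g j ∈ ys) → ∀ c → [ f , g ]′ c ∈ xs ++ ys
  [,]-∈-++ f∈ _  (inj₁ i) = ∈-++⁺ˡ (f∈ i)
  [,]-∈-++ _  g∈ (inj₂ j) = ∈-++⁺ʳ xs (g∈ j)

  [,]-injective : Disjoint xs ys → (∀ i → f i ∈ xs) → (∀ j → g j ∈ ys) →
                  Injective _≡_ _≡_ f → Injective _≡_ _≡_ g → Injective _≡_ _≡_ [ f , g ]′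
  [,]-injective _    _  _  f-inj _     {inj₁ i} {inj₁ _} eq = cong inj₁ (f-inj eq)
  [,]-injective _    _  _  _     g-inj {inj₂ j} {inj₂ _} eq = cong inj₂ (g-inj eq)
  [,]-injective disj f∈ g∈ _ _ {inj₁ i} {inj₂ j} eq =
    ⊥-elim (disj (f∈ i , subst (_∈ ys) (sym eq) (g∈ j)))
  [,]-injective disj f∈ g∈ _ _ {inj₂ j} {inj₁ i} eq =
    ⊥-elim (disj (f∈ i , subst (_∈ ys) eq (g∈ j)))

data LinkedView {A : Set} (R : Rel A 0ℓ) (xs : List A) : Set where
  linked : Linked R xs → LinkedView R xs
  broken : ∀ X a b Y → xs ≡ X ++ a ∷ b ∷ Y → ¬ R a b → LinkedView R xs

linkedView : ∀ {A : Set} {R : Rel A 0ℓ} → Decidable R → ∀ xs → LinkedView R xs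
linkedView R? []           = linked []
linkedView R? (x ∷ [])     = linked [-]
linkedView R? (x ∷ y ∷ xs) with R? x y | linkedView R? (y ∷ xs)
... | no ¬Rxy | _                      = broken [] x y xs refl ¬Rxy
... | yes Rxy | linked Ryxs            = linked (Rxy ∷ Ryxs)
... | yes _   | broken X a b Y eq ¬Rab = broken (x ∷ X) a b Y (cong (x ∷_) eq) ¬Rab

module _ {A : Set} {R : Rel A 0ℓ} where

  linked-∷ʳ : ∀ {z b} xs → Linked R (xs ∷ʳ z) → R z b → Linked R (xs ∷ʳ z ∷ʳ b)
  linked-∷ʳ []           [-]          Rzb = Rzb ∷ [-]
  linked-∷ʳ (x ∷ [])     (Rxz ∷ Rz)   Rzb = Rxz ∷ linked-∷ʳ [] Rz Rzb
  linked-∷ʳ (x ∷ y ∷ xs) (Rxy ∷ Ryxs) Rzb = Rxy ∷ linked-∷ʳ (y ∷ xs) Ryxs Rzb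

  linked-enter : ∀ {a b} W → Linked R (a ∷ W ++ [ b ]) → ∀ j → toℕ j ≡ 0 → R a (lookup W j)
  linked-enter (w ∷ W) (Raw ∷ _) zero _ = Raw

  linked-skip : ∀ {a b} W → Linked R (a ∷ W ++ [ b ]) → length W ≡ 0 → R a b
  linked-skip [] (Rab ∷ _) _ = Rab

  linked-step : ∀ {b} W → Linked R (W ++ [ b ]) → ∀ i j → toℕ j ≡ suc (toℕ i) →
                R (lookup W i) (lookup W j)
  linked-step (w ∷ w′ ∷ W) (Rww′ ∷ _) zero    (suc zero) _  = Rww′
  linked-step (w ∷ w′ ∷ W) (_ ∷ RW)   (suc i) (suc j)    eq = linked-step (w′ ∷ W) RW i j (suc-injective eq)

  linked-exit : ∀ {b} W → Linked R (W ++ [ b ]) → ∀ i → suc (toℕ i) ≡ length W → R (lookup W i) b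
  linked-exit (w ∷ [])     (Rwb ∷ _) zero    _  = Rwb
  linked-exit (w ∷ w′ ∷ W) (_ ∷ RW)  (suc i) eq = linked-exit (w′ ∷ W) RW i (suc-injective eq)

-- Forward arcs of an ordering

module Forward {V : Set} (arc : V → V → Bool) where

  _⇒_ : Rel V 0ℓ
  u ⇒ v = arc u v ≡ true

  _⇒?_ : Decidable _⇒_
  u ⇒? v = arc u v Bool.≟ true

  N⁺ N⁻ : V → List V → List V
  N⁺ y = filter (y ⇒?_)
  N⁻ y = filter (_⇒? y)

  d⁺ d⁻ : V → List V → ℕ
  d⁺ y M = length (N⁺ y M)
  d⁻ y M = length (N⁻ y M)

  forward : List V → ℕ
  forward []       = 0
  forward (x ∷ xs) = d⁺ x xs + forward xs

  d⁺-++ : ∀ y xs ys → d⁺ y (xs ++ ys) ≡ d⁺ y xs + d⁺ y ys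
  d⁺-++ y xs ys = trans (cong length (filter-++ (y ⇒?_) xs ys)) (length-++ (N⁺ y xs))

  d⁻-++ : ∀ y xs ys → d⁻ y (xs ++ ys) ≡ d⁻ y xs + d⁻ y ys
  d⁻-++ y xs ys = trans (cong length (filter-++ (_⇒? y) xs ys)) (length-++ (N⁻ y xs))

  d⁺-↭ : ∀ y {xs ys} → xs ↭ ys → d⁺ y xs ≡ d⁺ y ys
  d⁺-↭ y xs↭ys = ↭-length (filter-↭ (y ⇒?_) xs↭ys)

  d⁺-[]≡d⁻-[] : ∀ a b → d⁺ b [ a ] ≡ d⁻ a [ b ]
  d⁺-[]≡d⁻-[] a b with b ⇒? a
  ... | yes _ = refl
  ... | no  _ = refl

  forward-transpose : ∀ X a b R →
    forward (X ++ a ∷ b ∷ R) + d⁻ a [ b ] ≡ forward (X ++ b ∷ a ∷ R) + d⁺ a [ b ]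
  forward-transpose [] a b R = begin
    d⁺ a (b ∷ R) + (d⁺ b R + forward R) + d⁻ a [ b ]
      ≡⟨ cong (λ t → t + (d⁺ b R + forward R) + d⁻ a [ b ]) (d⁺-++ a [ b ] R) ⟩
    d⁺ a [ b ] + d⁺ a R + (d⁺ b R + forward R) + d⁻ a [ b ]
      ≡⟨ shuffle (d⁺ a [ b ]) (d⁺ a R) (d⁺ b R) (forward R) (d⁻ a [ b ]) ⟩
    d⁻ a [ b ] + d⁺ b R + (d⁺ a R + forward R) + d⁺ a [ b ]
      ≡⟨ cong (λ t → t + d⁺ b R + (d⁺ a R + forward R) + d⁺ a [ b ]) (d⁺-[]≡d⁻-[] a b) ⟨
    d⁺ b [ a ] + d⁺ b R + (d⁺ a R + forward R) + d⁺ a [ b ]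
      ≡⟨ cong (λ t → t + (d⁺ a R + forward R) + d⁺ a [ b ]) (d⁺-++ b [ a ] R) ⟨
    d⁺ b (a ∷ R) + (d⁺ a R + forward R) + d⁺ a [ b ]  ∎
    where
    open ≡-Reasoning
    shuffle : ∀ p q r f s → p + q + (r + f) + s ≡ s + r + (q + f) + p
    shuffle = solve-∀
  forward-transpose (x ∷ X) a b R = begin
    d⁺ x (X ++ a ∷ b ∷ R) + forward (X ++ a ∷ b ∷ R) + d⁻ a [ b ]
      ≡⟨ +-assoc (d⁺ x (X ++ a ∷ b ∷ R)) _ _ ⟩
    d⁺ x (X ++ a ∷ b ∷ R) + (forward (X ++ a ∷ b ∷ R) + d⁻ a [ b ])
      ≡⟨ cong₂ _+_ (d⁺-↭ x (↭-++⁺ˡ X (swap a b refl))) (forward-transpose X a b R) ⟩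
    d⁺ x (X ++ b ∷ a ∷ R) + (forward (X ++ b ∷ a ∷ R) + d⁺ a [ b ])
      ≡⟨ +-assoc (d⁺ x (X ++ b ∷ a ∷ R)) _ _ ⟨
    d⁺ x (X ++ b ∷ a ∷ R) + forward (X ++ b ∷ a ∷ R) + d⁺ a [ b ]  ∎
    where open ≡-Reasoning

  forward-move : ∀ X y M R →
    forward (X ++ y ∷ M ++ R) + d⁻ y M ≡ forward (X ++ M ++ y ∷ R) + d⁺ y M
  forward-move X y []      R = refl
  forward-move X y (m ∷ M) R = begin
    forward (X ++ y ∷ m ∷ M ++ R) + d⁻ y (m ∷ M)
      ≡⟨ cong (forward (X ++ y ∷ m ∷ M ++ R) +_) (d⁻-++ y [ m ] M) ⟩
    forward (X ++ y ∷ m ∷ M ++ R) + (d⁻ y [ m ] + d⁻ y M)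
      ≡⟨ +-assoc (forward (X ++ y ∷ m ∷ M ++ R)) _ _ ⟨
    forward (X ++ y ∷ m ∷ M ++ R) + d⁻ y [ m ] + d⁻ y M
      ≡⟨ cong (_+ d⁻ y M) (forward-transpose X y m (M ++ R)) ⟩
    forward (X ++ m ∷ y ∷ M ++ R) + d⁺ y [ m ] + d⁻ y M
      ≡⟨ xy∙z≈xz∙y +-commutativeSemigroup (forward (X ++ m ∷ y ∷ M ++ R)) _ _ ⟩
    forward (X ++ m ∷ y ∷ M ++ R) + d⁻ y M + d⁺ y [ m ]
      ≡⟨ cong (λ L → forward L + d⁻ y M + d⁺ y [ m ]) (∷ʳ-++ X m (y ∷ M ++ R)) ⟨
    forward (X ∷ʳ m ++ y ∷ M ++ R) + d⁻ y M + d⁺ y [ m ]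
      ≡⟨ cong (_+ d⁺ y [ m ]) (forward-move (X ∷ʳ m) y M R) ⟩
    forward (X ∷ʳ m ++ M ++ y ∷ R) + d⁺ y M + d⁺ y [ m ]
      ≡⟨ cong (λ L → forward L + d⁺ y M + d⁺ y [ m ]) (∷ʳ-++ X m (M ++ y ∷ R)) ⟩
    forward (X ++ m ∷ M ++ y ∷ R) + d⁺ y M + d⁺ y [ m ]
      ≡⟨ +-assoc (forward (X ++ m ∷ M ++ y ∷ R)) _ _ ⟩
    forward (X ++ m ∷ M ++ y ∷ R) + (d⁺ y M + d⁺ y [ m ])
      ≡⟨ cong (forward (X ++ m ∷ M ++ y ∷ R) +_) (trans (+-comm (d⁺ y M) _) (sym (d⁺-++ y [ m ] M))) ⟩
    forward (X ++ m ∷ M ++ y ∷ R) + d⁺ y (m ∷ M)  ∎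
    where open ≡-Reasoning

  forward-later : ∀ X y M R → d⁺ y M < d⁻ y M →
                  forward (X ++ y ∷ M ++ R) < forward (X ++ M ++ y ∷ R)
  forward-later X y M R = exchange-< (sym (forward-move X y M R))

  forward-earlier : ∀ X y M R → d⁻ y M < d⁺ y M →
                    forward (X ++ M ++ y ∷ R) < forward (X ++ y ∷ M ++ R)
  forward-earlier X y M R = exchange-< (forward-move X y M R)

  forward≤length² : ∀ xs → forward xs ≤ length xs * length xs
  forward≤length² []       = z≤n
  forward≤length² (x ∷ xs) = begin
    d⁺ x xs + forward xs                     ≤⟨ +-mono-≤ (length-filter (x ⇒?_) xs) (forward≤length² xs) ⟩
    length xs + length xs * length xs        ≤⟨ +-monoʳ-≤ (length xs) (*-monoʳ-≤ (length xs) (n≤1+n _)) ⟩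
    length xs + length xs * suc (length xs)  ≤⟨ n≤1+n _ ⟩
    suc (length xs) * suc (length xs)        ∎
    where open ≤-Reasoning

-- Tournaments

module _ {n : ℕ} (T : Tournament n) where

  open Tournament T
  open Forward arc

  ⇒-irrefl : ∀ {v} → ¬ v ⇒ v
  ⇒-irrefl {v} v⇒v with () ← trans (sym (irrefl v)) v⇒v

  d⁺+d⁻ : ∀ {y} M → y ∉ M → d⁺ y M + d⁻ y M ≡ length M
  d⁺+d⁻ []          _   = refl
  d⁺+d⁻ {y} (m ∷ M) y∉M with arc y m | arc m y | tournament y m (y∉M ∘ here)
  ... | true  | false | _ = cong suc (d⁺+d⁻ M (y∉M ∘ there))
  ... | false | true  | _ = trans (+-suc _ _) (cong suc (d⁺+d⁻ M (y∉M ∘ there)))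

  out-minority : ∀ {y M s} → y ∉ M → s + s ≤ length M → d⁺ y M < s → d⁺ y M < d⁻ y M
  out-minority {M = M} y∉M 2s≤ = minority (subst (_ ≤_) (sym (d⁺+d⁻ M y∉M)) 2s≤)

  in-minority : ∀ {y M s} → y ∉ M → s + s ≤ length M → d⁻ y M < s → d⁻ y M < d⁺ y M
  in-minority {y} {M} y∉M 2s≤ =
    minority (subst (_ ≤_) (trans (sym (d⁺+d⁻ M y∉M)) (+-comm (d⁺ y M) _)) 2s≤)

  reversed-pair : ∀ {a b} → a ≢ b → ¬ a ⇒ b → d⁺ a [ b ] < d⁻ a [ b ]
  reversed-pair {a} {b} a≢b a⇏b with arc a b | arc b a | tournament a b a≢b
  ... | false | true | _ = s≤s z≤n
  ... | true  | _    | _ = ⊥-elim (a⇏b refl)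

  record Skeleton (s₁ k s₂ : ℕ) : Set where
    constructor skeleton
    field
      sources path sinks : List (Fin n)
      distinct           : Unique (sources ++ path ++ sinks)
      enough-sources     : s₁ ≤ length sources
      path-length        : length path ≡ k
      enough-sinks       : s₂ ≤ length sinks
      spine              : ∀ {a b} → a ∈ sources → b ∈ sinks → Linked _⇒_ (a ∷ path ++ [ b ])

  -- The spine constrains the path only through some source and some sink, hence 1 ≤ s₁ and 1 ≤ s₂.
  skeleton⇒broom : ∀ {s₁ k s₂} → 1 ≤ s₁ → 1 ≤ s₂ → Skeleton s₁ k s₂ →
                   ContainsBroom T (suc k) s₁ s₂
  skeleton⇒broom (s≤s z≤n) (s≤s z≤n) (skeleton A W B distinct A≥ refl B≥ spine) = f , injective , arcs
    where
    f : BroomV (suc (length W)) _ _ → Fin n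
    f = [ pick A A≥ , [ lookup W , pick B B≥ ]′ ]′

    W++B! : Unique (W ++ B)
    W++B! = Unique-++⁻ʳ A distinct

    injective : Injective _≡_ _≡_ f
    injective =
      [,]-injective (Unique-++⇒Disjoint A distinct) (pick-∈ A≥) ([,]-∈-++ (∈-lookup {xs = W}) (pick-∈ B≥))
        (pick-injective A≥ (Unique-++⁻ˡ A distinct))
        ([,]-injective (Unique-++⇒Disjoint W W++B!) ∈-lookup (pick-∈ B≥)
          (lookup-injective (Unique-++⁻ˡ W W++B!)) (pick-injective B≥ (Unique-++⁻ʳ W W++B!)))

    a₀∈ : pick A A≥ zero ∈ A
    a₀∈ = pick-∈ A≥ zero
    b₀∈ : pick B B≥ zero ∈ B
    b₀∈ = pick-∈ B≥ zero

    arcs : ∀ u v → BroomArc (suc (length W)) _ _ u v → f u ⇒ f v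
    arcs (inj₁ a)        (inj₂ (inj₁ j)) j≡0   = linked-enter W (spine (pick-∈ A≥ a) b₀∈) j j≡0
    arcs (inj₁ a)        (inj₂ (inj₂ b)) ℓ≡1   =
      linked-skip W (spine (pick-∈ A≥ a) (pick-∈ B≥ b)) (suc-injective ℓ≡1)
    arcs (inj₂ (inj₁ i)) (inj₂ (inj₁ j)) j≡1+i = linked-step W (tail (spine a₀∈ b₀∈)) i j j≡1+i
    arcs (inj₂ (inj₁ i)) (inj₂ (inj₂ b)) 1+i≡ℓ = linked-exit W (tail (spine a₀∈ (pick-∈ B≥ b))) i 1+i≡ℓ

  record Biclique (R : List (Fin n)) (a b : ℕ) : Set where
    constructor biclique
    field
      sources sinks  : List (Fin n)
      sources⊆       : sources ⊆ R
      sinks⊆         : sinks ⊆ R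
      enough-sources : a ≤ length sources
      enough-sinks   : b ≤ length sinks
      dominates      : ∀ {x y} → x ∈ sources → y ∈ sinks → x ⇒ y

  biclique-cons-source : ∀ {v R a b} → Biclique (N⁺ v R) a b → Biclique (v ∷ R) (suc a) b
  biclique-cons-source {v} {R} (biclique A B A⊆ B⊆ a≤ b≤ dom) =
    biclique (v ∷ A) B (refl ∷ ⊆-trans A⊆ (filter-⊆ _ R)) (++⁺ˡ [ v ] (⊆-trans B⊆ (filter-⊆ _ R)))
             (s≤s a≤) b≤ dom′
    where
    dom′ : ∀ {x y} → x ∈ v ∷ A → y ∈ B → x ⇒ y
    dom′ (here refl) y∈B = proj₂ (∈-filter⁻ (v ⇒?_) {xs = R} (Sublist.lookup B⊆ y∈B))
    dom′ (there x∈A) y∈B = dom x∈A y∈B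

  biclique-cons-sink : ∀ {v R a b} → Biclique (N⁻ v R) a b → Biclique (v ∷ R) a (suc b)
  biclique-cons-sink {v} {R} (biclique A B A⊆ B⊆ a≤ b≤ dom) =
    biclique A (v ∷ B) (++⁺ˡ [ v ] (⊆-trans A⊆ (filter-⊆ _ R))) (refl ∷ ⊆-trans B⊆ (filter-⊆ _ R))
             a≤ (s≤s b≤) dom′
    where
    dom′ : ∀ {x y} → x ∈ A → y ∈ v ∷ B → x ⇒ y
    dom′ x∈A (here refl) = proj₂ (∈-filter⁻ (_⇒? v) {xs = R} (Sublist.lookup A⊆ x∈A))
    dom′ x∈A (there y∈B) = dom x∈A y∈B

  biclique-exists : ∀ a b R → Unique R → 2 ^ (a + b) ≤ length R → Biclique R a b
  biclique-exists zero    b    R _ big =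
    biclique [] R ([]⊆-universal R) ⊆-refl z≤n (≤-trans (<⇒≤ (n<2^n b)) big) (λ ())
  biclique-exists (suc a) zero R _ big =
    biclique R [] ⊆-refl ([]⊆-universal R)
             (≤-trans (<⇒≤ (n<2^n (suc a))) (subst (λ e → 2 ^ e ≤ length R) (+-identityʳ (suc a)) big))
             z≤n (λ _ ())
  biclique-exists (suc a) (suc b) []      _ big = ⊥-elim (<⇒≱ (m^n>0 2 (suc a + suc b)) big)
  biclique-exists (suc a) (suc b) (v ∷ R) vR!@(_ ∷ R!) big with 2 ^ (a + suc b) ≤? d⁺ v R
  ... | yes many-out =
    biclique-cons-source (biclique-exists a (suc b) (N⁺ v R) (Unique-filter⁺ _ R!) many-out)
  ... | no  few-out  =
    biclique-cons-sink (biclique-exists (suc a) b (N⁻ v R) (Unique-filter⁺ _ R!) many-in)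
    where
    M : ℕ
    M = 2 ^ (a + suc b)
    many-in : 2 ^ (suc a + b) ≤ d⁻ v R
    many-in = subst (λ e → 2 ^ e ≤ d⁻ v R) (+-suc a b) (majority (begin
      M + M                  ≡⟨ cong (M +_) (+-identityʳ M) ⟨
      2 ^ (suc a + suc b)    ≤⟨ big ⟩
      suc (length R)         ≡⟨ cong suc (d⁺+d⁻ R (Unique[x∷xs]⇒x∉xs vR!)) ⟨
      suc (d⁺ v R + d⁻ v R)  ∎) (≰⇒> few-out))
      where open ≤-Reasoning

  biclique⇒skeleton : ∀ {R a b} → Unique R → Biclique R a b → Skeleton a 0 b
  biclique⇒skeleton R! (biclique A B A⊆ B⊆ a≤ b≤ dom) =
    skeleton A [] B (Unique-++⁺ (Unique-resp-⊇ A⊆ R!) (Unique-resp-⊇ B⊆ R!) disjoint) a≤ refl b≤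
             (λ a∈A b∈B → dom a∈A b∈B ∷ [-])
    where
    disjoint : Disjoint A B
    disjoint (v∈A , v∈B) = ⇒-irrefl (dom v∈A v∈B)

  module Median (U : List (Fin n)) (U! : Unique U) (s₁ s₂ j : ℕ) where

    record Arrangement : Set where
      constructor arrangement
      field
        front middle back : List (Fin n)
        front-length      : length front ≡ s₁ + s₁
        middle-length     : length middle ≡ suc j
        back-length       : s₂ + s₂ ≤ length back
        ordering          : front ++ middle ++ back ↭ U

    open Arrangement

    order : Arrangement → List (Fin n)
    order σ = front σ ++ middle σ ++ back σ

    order-unique : ∀ σ → Unique (order σ)
    order-unique σ = Unique-resp-↭ (↭-sym (ordering σ)) U!

    Improvement : Arrangement → Set
    Improvement σ = Σ Arrangement λ σ′ → forward (order σ) < forward (order σ′)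

    swap-descent : ∀ σ {X a b Y} → middle σ ≡ X ++ a ∷ b ∷ Y → ¬ a ⇒ b → Improvement σ
    swap-descent σ@(arrangement P _ S P-len W-len S-len ord) {X} {a} {b} {Y} refl a⇏b =
      arrangement P (X ++ b ∷ a ∷ Y) S P-len (trans (↭-length W′↭W) W-len) S-len
                  (↭-trans (↭-++⁺ˡ P (↭-++⁺ʳ S W′↭W)) ord) ,
      subst₂ (λ L L′ → forward L < forward L′) (sym (regroup P X _ S)) (sym (regroup P X _ S))
             (forward-later (P ++ X) a [ b ] (Y ++ S) (reversed-pair a≢b a⇏b))
      where
      W′↭W : X ++ b ∷ a ∷ Y ↭ X ++ a ∷ b ∷ Y
      W′↭W = ↭-++⁺ˡ X (swap b a refl)
      a≢b : a ≢ b
      a≢b with (a≢b ∷ _) ∷ _ ← Unique-++⁻ʳ (P ++ X) (subst Unique (regroup P X _ S) (order-unique σ))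
        = a≢b

    pull-head : ∀ σ {y W} → middle σ ≡ y ∷ W → d⁻ y (front σ) < s₁ → Improvement σ
    pull-head σ@(arrangement P _ S P-len W-len S-len ord) {y} {W} refl few-in
      with P′ , u , y∷P≡P′∷ʳu ← unsnoc y P =
      arrangement P′ (u ∷ W) S P′-len W-len S-len
                  (subst (_↭ U) (sym order≡) (↭-trans (↭-sym (shift y P (W ++ S))) ord)) ,
      subst (λ L → forward (P ++ y ∷ W ++ S) < forward L) (sym order≡)
            (forward-earlier [] y P (W ++ S) (in-minority y∉P (≤-reflexive (sym P-len)) few-in))
      where
      order≡ : P′ ++ (u ∷ W) ++ S ≡ y ∷ P ++ W ++ S
      order≡ = trans (sym (∷ʳ-++ P′ u (W ++ S))) (cong (_++ W ++ S) (sym y∷P≡P′∷ʳu))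
      P′-len : length P′ ≡ s₁ + s₁
      P′-len = trans (suc-injective (trans (↭-length (∷↭∷ʳ u P′)) (cong length (sym y∷P≡P′∷ʳu))))
                     P-len
      y∉P : y ∉ P
      y∉P y∈P = Unique-++⇒Disjoint P (order-unique σ) (y∈P , here refl)

    push-last : ∀ σ {W z} → middle σ ≡ W ∷ʳ z → d⁺ z (back σ) < s₂ → Improvement σ
    push-last (arrangement _ _ [] _ _ S-len _) refl few-out =
      ⊥-elim (<⇒≱ (<-≤-trans few-out (m≤m+n s₂ s₂)) S-len)
    push-last σ@(arrangement P _ (s ∷ S) P-len W-len S-len ord) {W} {z} refl few-out =
      arrangement P (W ∷ʳ s) (S ∷ʳ z) P-len W′-len S′-len
                  (subst (_↭ U) (sym (regroup P W [ s ] (S ∷ʳ z)))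
                    (↭-trans (↭-++⁺ˡ (P ++ W) (↭-sym (∷↭∷ʳ z (s ∷ S)))) old-order)) ,
      subst₂ (λ L L′ → forward L < forward L′) old≡ (sym (regroup P W [ s ] (S ∷ʳ z)))
             (forward-later (P ++ W) z (s ∷ S) [] (out-minority z∉S S-len few-out))
      where
      old≡ : (P ++ W) ++ z ∷ (s ∷ S) ++ [] ≡ P ++ (W ∷ʳ z) ++ s ∷ S
      old≡ = trans (cong (λ L → (P ++ W) ++ z ∷ L) (++-identityʳ (s ∷ S))) (sym (regroup P W [ z ] (s ∷ S)))
      old-order : (P ++ W) ++ z ∷ s ∷ S ↭ U
      old-order = subst (_↭ U) (regroup P W [ z ] (s ∷ S)) ord
      W′-len : length (W ∷ʳ s) ≡ suc j
      W′-len = trans (length-++ W) (trans (sym (length-++ W)) W-len)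
      S′-len : s₂ + s₂ ≤ length (S ∷ʳ z)
      S′-len = ≤-trans S-len (≤-reflexive (↭-length (∷↭∷ʳ z S)))
      z∉S : z ∉ s ∷ S
      z∉S = Unique[x∷xs]⇒x∉xs
              (Unique-++⁻ʳ (P ++ W) (subst Unique (regroup P W [ z ] (s ∷ S)) (order-unique σ)))

    improve : ∀ σ → Skeleton s₁ (suc j) s₂ ⊎ Improvement σ
    improve σ@(arrangement P (y ∷ W) S _ W-len _ _) with linkedView _⇒?_ (y ∷ W)
    ... | broken X a b Y y∷W≡ a⇏b = inj₂ (swap-descent σ y∷W≡ a⇏b)
    ... | linked path with d⁻ y P <? s₁
    ...   | yes few-in = inj₂ (pull-head σ refl few-in)
    ...   | no many-in with W₀ , z , y∷W≡W₀∷ʳz ← unsnoc y W with d⁺ z S <? s₂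
    ...     | yes few-out = inj₂ (push-last σ y∷W≡W₀∷ʳz few-out)
    ...     | no many-out =
      inj₁ (skeleton (N⁻ y P) (y ∷ W) (N⁺ z S) distinct (≮⇒≥ many-in) W-len (≮⇒≥ many-out) spine)
      where
      distinct : Unique (N⁻ y P ++ (y ∷ W) ++ N⁺ z S)
      distinct = Unique-resp-⊇ (++⁺ (filter-⊆ _ P) (++⁺ ⊆-refl (filter-⊆ _ S))) (order-unique σ)
      spine : ∀ {a b} → a ∈ N⁻ y P → b ∈ N⁺ z S → Linked _⇒_ (a ∷ (y ∷ W) ++ [ b ])
      spine a∈ b∈ =
        proj₂ (∈-filter⁻ (_⇒? y) {xs = P} a∈) ∷
        subst (λ L → Linked _⇒_ (L ∷ʳ _)) (sym y∷W≡W₀∷ʳz)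
              (linked-∷ʳ W₀ (subst (Linked _⇒_) y∷W≡W₀∷ʳz path)
                            (proj₂ (∈-filter⁻ (z ⇒?_) {xs = S} b∈)))

    initial : s₁ + s₁ + (suc j + (s₂ + s₂)) ≤ length U → Arrangement
    initial fits with P , R , P++R≡U , P-len , R-len ← split-at (s₁ + s₁) U fits
                 with W , S , W++S≡R , W-len , S-len ← split-at (suc j) R R-len =
      arrangement P W S P-len W-len S-len (↭-reflexive (trans (cong (P ++_) W++S≡R) P++R≡U))

    skeleton-by-median : s₁ + s₁ + (suc j + (s₂ + s₂)) ≤ length U → Skeleton s₁ (suc j) s₂
    skeleton-by-median fits = hill-climb (forward ∘ order) (length U * length U) bounded improve (initial fits)
      where
      bounded : ∀ σ → forward (order σ) ≤ length U * length U
      bounded σ = subst (λ m → forward (order σ) ≤ m * m) (↭-length (ordering σ))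
                        (forward≤length² (order σ))

proposition5p3 : (ℓ s₁ s₂ n : ℕ) → 1 ≤ ℓ → 1 ≤ s₁ → 1 ≤ s₂ →
                 ℓ + 2 ^ (s₁ + s₂) ≤ n →
                 (T : Tournament n) → ContainsBroom T ℓ s₁ s₂
proposition5p3 (suc k) s₁ s₂ n _ 1≤s₁ 1≤s₂ fits T =
  skeleton⇒broom T 1≤s₁ 1≤s₂ (skeleton-of k (subst (_ ≤_) (sym (length-allFin n)) fits))
  where
  skeleton-of : ∀ k → suc k + 2 ^ (s₁ + s₂) ≤ length (allFin n) → Skeleton T s₁ k s₂
  skeleton-of zero    fits = biclique⇒skeleton T (allFin⁺ n)
    (biclique-exists T s₁ s₂ (allFin n) (allFin⁺ n) (≤-trans (n≤1+n _) fits))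
  skeleton-of (suc j) fits = Median.skeleton-by-median T (allFin n) (allFin⁺ n) s₁ s₂ j
    (≤-trans (blocks-fit s₁ s₂ (suc j)) fits)
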